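{- Let $S$ be a numerical semigroup of depth $q\ge 4$ such that $|L|\le 12$. If $\alpha_1=2$, then $q=4$ and $W_0(S)\ge 0$.
   Context: A numerical semigroup is a submonoid $S$ of $(\mathbb N,+)$ with $\mathbb N\setminus S$ finite. Let $S^*=S\setminus\{0\}$, $m=\min S^*$ (multiplicity), $c$ the least $c\in\mathbb N$ with $[c,\infty[\subseteq S$ (conductor), $L=S\cap[0,c-1]$ (left part), $P$ the set of primitive elements of $S$ (elements of $S^*$ not a sum of two elements of $S^*$), and $D=S^*\setminus P$. The depth is $q=\lceil c/m\rceil$ and the offset is $\rho=qm-c\in[0,m-1]$. For $j\in\mathbb Z$ let $I_j=[jm-\rho,(j+1)m-\rho-1]$ and $D_j=D\cap I_j$. Let $A=\{x\in S: x-m\notin S\}$ be the Apéry set with respect to $m$ and $\alpha_1=|A\cap I_1|$. Define $W_0(S)=|P\cap L|\,|L|-q|D_q|+\rho$. -}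

module Defs where

open import Data.Nat using (ℕ; zero; suc; _+_; _*_; _∸_; _≤_; _<_; s≤s; z≤n)
open import Data.Nat.Properties using (m+n∸m≡n; m<m+n; +-comm; m∸n+n≡m; _≤?_; ≤-refl)
open import Data.Product using (Σ; ∃; _×_; _,_; proj₁; proj₂)
open import Data.Sum using (_⊎_; inj₁; inj₂)
open import Data.Bool using (Bool; true; false; if_then_else_)
open import Relation.Nullary using (Dec; yes; no; ¬_; does)
open import Relation.Nullary.Decidable using (_×-dec_; ¬?)
open import Relation.Unary using (Pred; Decidable)
open import Relation.Binary.PropositionalEquality using (_≡_; refl; sym; trans; cong; subst)
open import Level using (0ℓ)
import Data.Nat.Properties
import Data.Empty
open import Data.Integer using (ℤ; +_)
import Data.Integer as ℤ

-- Membership is required to be decidable so that cardinalities of the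
-- (finite) sets occurring below can be computed by counting.

record NumericalSemigroup : Set₁ where
  field
    _∈S    : ℕ → Set
    _∈S?   : Decidable _∈S
    0∈S    : 0 ∈S
    +-closed : ∀ {x y} → x ∈S → y ∈S → (x + y) ∈S
    cofinite : ∃ λ N → ∀ n → N ≤ n → n ∈S

open NumericalSemigroup public

IsMultiplicity : NumericalSemigroup → ℕ → Set
IsMultiplicity S m = (_∈S S m) × 0 < m × (∀ x → _∈S S x → 0 < x → m ≤ x)

IsConductor : NumericalSemigroup → ℕ → Set
IsConductor S c = (∀ n → c ≤ n → _∈S S n)
                × (∀ c' → (∀ n → c' ≤ n → _∈S S n) → c ≤ c')

IsCeilDiv : ℕ → ℕ → ℕ → Set
IsCeilDiv c m q = c ≤ q * m × q * m < c + m

-- offset ρ = qm - c  (nonnegative when q = ⌈c/m⌉)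
offset : ℕ → ℕ → ℕ → ℕ
offset c m q = q * m ∸ c

NonzeroElem : NumericalSemigroup → ℕ → Set
NonzeroElem S x = _∈S S x × 0 < x

Decomposable : NumericalSemigroup → ℕ → Set
Decomposable S x = Σ ℕ λ a → Σ ℕ λ b →
  NonzeroElem S a × NonzeroElem S b × a + b ≡ x

Primitive : NumericalSemigroup → ℕ → Set
Primitive S x = NonzeroElem S x × ¬ Decomposable S x

InD : NumericalSemigroup → ℕ → Set
InD S x = NonzeroElem S x × ¬ Primitive S x

-- Apéry set: x ∈ S with x - m ∉ S (x - m taken in ℤ; negative ⇒ ∉ S)
InApery : NumericalSemigroup → ℕ → ℕ → Set
InApery S m x = _∈S S x × (m ≤ x → ¬ _∈S S (x ∸ m))

private
  boundedEx? : (P : ℕ → Set) → Decidable P → (n : ℕ) → Dec (Σ ℕ λ k → k < n × P k)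
  boundedEx? P P? zero = no λ { (k , () , _) }
  boundedEx? P P? (suc n) with P? n
  ... | yes p = yes (n , ≤-refl , p)
  ... | no ¬p with boundedEx? P P? n
  ...   | yes (k , k<n , pk) = yes (k , Data.Nat.Properties.m≤n⇒m≤1+n k<n , pk)
  ...   | no ¬e = no λ { (k , k<1+n , pk) → helper k k<1+n pk }
    where
      helper : ∀ k → k < suc n → P k → Data.Empty.⊥
      helper k k<1+n pk with Data.Nat.Properties.m<1+n⇒m<n∨m≡n k<1+n
      ... | inj₁ k<n = ¬e (k , k<n , pk)
      ... | inj₂ refl = ¬p pk

nonzeroElem? : (S : NumericalSemigroup) → Decidable (NonzeroElem S)
nonzeroElem? S x = _∈S? S x ×-dec (1 ≤? x)

decomposable? : (S : NumericalSemigroup) → Decidable (Decomposable S)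
decomposable? S x with boundedEx? Q (λ a → nonzeroElem? S a ×-dec nonzeroElem? S (x ∸ a)) x
  where Q = λ a → NonzeroElem S a × NonzeroElem S (x ∸ a)
... | yes (a , a<x , na , nb) =
  yes (a , x ∸ a , na , nb , trans (+-comm a (x ∸ a)) (m∸n+n≡m (Data.Nat.Properties.<⇒≤ a<x)))
... | no ¬e = no λ { (a , b , na , nb , refl) →
  ¬e (a , m<m+n a (proj₂ nb) , na , subst (NonzeroElem S) (sym (m+n∸m≡n a b)) nb) }

primitive? : (S : NumericalSemigroup) → Decidable (Primitive S)
primitive? S x = nonzeroElem? S x ×-dec ¬? (decomposable? S x)

inD? : (S : NumericalSemigroup) → Decidable (InD S)
inD? S x = nonzeroElem? S x ×-dec ¬? (primitive? S x)

inApery? : (S : NumericalSemigroup) (m : ℕ) → Decidable (InApery S m)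
inApery? S m x with _∈S? S x | m ≤? x
... | no ¬s | _ = no λ z → ¬s (proj₁ z)
... | yes s | no m≰x = yes (s , λ m≤x → Data.Empty.⊥-elim (m≰x m≤x))
... | yes s | yes m≤x with _∈S? S (x ∸ m)
...   | yes s' = no λ z → proj₂ z m≤x s'
...   | no ¬s' = yes (s , λ _ → ¬s')

countIn : {P : ℕ → Set} → Decidable P → ℕ → ℕ → ℕ
countIn P? a zero = 0
countIn P? a (suc len) = (if does (P? a) then 1 else 0) + countIn P? (suc a) len

cardL : NumericalSemigroup → (c : ℕ) → ℕ
cardL S c = countIn (_∈S? S) 0 c

cardPL : NumericalSemigroup → (c : ℕ) → ℕ
cardPL S c = countIn (primitive? S) 0 c

-- I_j = [jm - ρ, (j+1)m - ρ - 1]  (an interval of length m), for j ≥ 1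
-- (then jm - ρ ≥ m - ρ ≥ 1, so truncated subtraction is exact)
intervalStart : (m ρ j : ℕ) → ℕ
intervalStart m ρ j = j * m ∸ ρ

cardD : NumericalSemigroup → (m ρ j : ℕ) → ℕ
cardD S m ρ j = countIn (inD? S) (intervalStart m ρ j) m

alpha1 : NumericalSemigroup → (m ρ : ℕ) → ℕ
alpha1 S m ρ = countIn (inApery? S m) (intervalStart m ρ 1) m

W0 : NumericalSemigroup → (m c q : ℕ) → ℤ
W0 S m c q =
  (+ (cardPL S c * cardL S c) ℤ.- + (q * cardD S m (offset c m q) q)) ℤ.+ + offset c m q

-- Let A be the Apéry set of m and r = m − ρ, so that I_j = [r + (j − 1)m, r + jm).  Every element of
-- S lies either in A or in m + S, hence |S ∩ [0, n + m)| = |A ∩ [0, n + m)| + |S ∩ [0, n)|, and S meets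
-- each window [n, n + m) in |A ∩ [0, n + m)| elements.  As S ∩ [0, r) = {0} and α₁ = 2, we get
-- |A ∩ [0, r + m)| = 3, so |S ∩ [0, r + 4m)| ≥ 1 + 4·3 = 13: depth q ≥ 5 contradicts |L| ≤ 12.
-- For q = 4 the same recursion gives |L| = 10 + 2α₂ + α₃, so 2α₂ + α₃ ≤ 2.  An element of D_4 either
-- lies in m + S (at most 3 + α₂ + α₃ of them) or is a sum of two nonzero Apéry elements below c, one
-- from I₂ ∪ I₃ and the other from I₁ ∪ I₂; hence |D_4| ≤ 3 + α₂ + α₃ + (α₂ + α₃)(2 + α₂).  The
-- elements of S ∩ I₁ lie below 2m and are primitive, so |P ∩ L| ≥ 3, and 4|D_4| ≤ 3|L| ≤ |P ∩ L||L|
-- in each of the four remaining cases for (α₂, α₃).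
module Submission where

open import Defs
open import Data.Nat using (ℕ; _≤_)
open import Data.Integer using (+_)
import Data.Integer as ℤ
open import Data.Product using (_×_)
open import Relation.Binary.PropositionalEquality using (_≡_)

open import Data.Nat using (zero; suc; _+_; _*_; _∸_; _<_; z≤n; s≤s)
open import Data.Nat.Properties
open import Data.Bool using (if_then_else_)
open import Data.Empty using (⊥-elim)
open import Data.List using (List; []; _∷_; _++_; length; filter; map; cartesianProductWith)
open import Data.List.Properties using (length-++; length-map)
open import Data.List.Membership.Propositional using (_∈_)
open import Data.List.Membership.DecPropositional _≟_ using (_∈?_)
open import Data.List.Relation.Unary.Any using (here; there)
open import Data.List.Membership.Propositional.Properties
  using (∈-filter⁺; ∈-++⁺ˡ; ∈-++⁺ʳ; ∈-cartesianProductWith⁺)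
open import Data.Product using (Σ; _,_; proj₁; proj₂)
open import Data.Sum using (_⊎_; inj₁; inj₂; [_,_])
import Data.Sum as Sum
open import Function using (_∘_)
open import Function.Bundles using (_⇔_; mk⇔)
open import Level using (0ℓ)
open import Relation.Nullary using (Dec; yes; no; ¬_; does)
open import Relation.Nullary.Decidable using (_⊎-dec_; _×-dec_; does-⇔)
open import Relation.Unary using (Pred; Decidable)
open import Relation.Binary.PropositionalEquality
  using (refl; sym; trans; cong; cong₂; subst; subst₂; module ≡-Reasoning)
open import Data.Nat.Tactic.RingSolver using (solve-∀)
import Data.Integer.Properties as ℤP
open import Algebra.Properties.CommutativeSemigroup +-commutativeSemigroup using (interchange)

private variable
  A B C : Set
  P Q R : Pred ℕ 0ℓ
  lo len x : ℕ

InRange : ℕ → ℕ → ℕ → Set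
InRange lo len x = lo ≤ x × x < lo + len

private
  inRange-head : InRange lo (suc len) lo
  inRange-head {lo} = ≤-refl , m<m+n lo (s≤s z≤n)

  inRange-tail : InRange (suc lo) len x → InRange lo (suc len) x
  inRange-tail {lo} {len} {x} (lo<x , x<) = <⇒≤ lo<x , subst (x <_) (sym (+-suc lo len)) x<

  ind : Dec A → ℕ
  ind a? = if does a? then 1 else 0

  ind-mono : (A → B) → (a? : Dec A) (b? : Dec B) → ind a? ≤ ind b?
  ind-mono f (yes a) (yes _) = ≤-refl
  ind-mono f (yes a) (no ¬b) = ⊥-elim (¬b (f a))
  ind-mono f (no _)  _       = z≤n

  ind-⊎ : (a? : Dec A) (b? : Dec B) → ind (a? ⊎-dec b?) ≤ ind a? + ind b?
  ind-⊎ (yes _) _       = s≤s z≤n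
  ind-⊎ (no _)  (yes _) = ≤-refl
  ind-⊎ (no _)  (no _)  = z≤n

  ind-⊎-disjoint : (A → ¬ B) → (a? : Dec A) (b? : Dec B) → ind (a? ⊎-dec b?) ≡ ind a? + ind b?
  ind-⊎-disjoint disj (yes a) (yes b) = ⊥-elim (disj a b)
  ind-⊎-disjoint disj (yes _) (no _)  = refl
  ind-⊎-disjoint disj (no _)  (yes _) = refl
  ind-⊎-disjoint disj (no _)  (no _)  = refl

countIn-++ : (P? : Decidable P) (lo l₁ l₂ : ℕ) →
  countIn P? lo (l₁ + l₂) ≡ countIn P? lo l₁ + countIn P? (lo + l₁) l₂
countIn-++ P? lo zero l₂ rewrite +-identityʳ lo = refl
countIn-++ P? lo (suc l₁) l₂ rewrite +-suc lo l₁ =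
  trans (cong (_+_ (ind (P? lo))) (countIn-++ P? (suc lo) l₁ l₂)) (sym (+-assoc (ind (P? lo)) _ _))

countIn-mono-len : (P? : Decidable P) (lo : ℕ) {l₁ l₂ : ℕ} → l₁ ≤ l₂ →
  countIn P? lo l₁ ≤ countIn P? lo l₂
countIn-mono-len P? lo {l₁} {l₂} l₁≤l₂ = begin
  countIn P? lo l₁                                  ≤⟨ m≤m+n _ _ ⟩
  countIn P? lo l₁ + countIn P? (lo + l₁) (l₂ ∸ l₁) ≡⟨ countIn-++ P? lo l₁ (l₂ ∸ l₁) ⟨
  countIn P? lo (l₁ + (l₂ ∸ l₁))                    ≡⟨ cong (countIn P? lo) (m+[n∸m]≡n l₁≤l₂) ⟩
  countIn P? lo l₂                                  ∎
  where open ≤-Reasoning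

countIn-mono : (P? : Decidable P) (Q? : Decidable Q) (lo len : ℕ) →
  (∀ {x} → InRange lo len x → P x → Q x) → countIn P? lo len ≤ countIn Q? lo len
countIn-mono P? Q? lo zero      P⇒Q = z≤n
countIn-mono P? Q? lo (suc len) P⇒Q =
  +-mono-≤ (ind-mono (P⇒Q inRange-head) (P? lo) (Q? lo))
           (countIn-mono P? Q? (suc lo) len (P⇒Q ∘ inRange-tail))

countIn-⊎ : (Q? : Decidable Q) (R? : Decidable R) (lo len : ℕ) →
  countIn (λ x → Q? x ⊎-dec R? x) lo len ≤ countIn Q? lo len + countIn R? lo len
countIn-⊎ Q? R? lo zero = z≤n
countIn-⊎ Q? R? lo (suc len) = ≤-trans
  (+-mono-≤ (ind-⊎ (Q? lo) (R? lo)) (countIn-⊎ Q? R? (suc lo) len))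
  (≤-reflexive (interchange (ind (Q? lo)) (ind (R? lo)) _ _))

countIn-⊎-disjoint : (Q? : Decidable Q) (R? : Decidable R) → (∀ {x} → Q x → ¬ R x) →
  (lo len : ℕ) → countIn (λ x → Q? x ⊎-dec R? x) lo len ≡ countIn Q? lo len + countIn R? lo len
countIn-⊎-disjoint Q? R? disj lo zero = refl
countIn-⊎-disjoint Q? R? disj lo (suc len) = trans
  (cong₂ _+_ (ind-⊎-disjoint disj (Q? lo) (R? lo)) (countIn-⊎-disjoint Q? R? disj (suc lo) len))
  (interchange (ind (Q? lo)) (ind (R? lo)) _ _)

countIn-cong : (P? : Decidable P) (Q? : Decidable Q) → (∀ x → P x ⇔ Q x) →
  (lo len : ℕ) → countIn P? lo len ≡ countIn Q? lo len
countIn-cong P? Q? P⇔Q lo zero = refl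
countIn-cong P? Q? P⇔Q lo (suc len) =
  cong₂ _+_ (cong (λ b → if b then 1 else 0) (does-⇔ (P⇔Q lo) (P? lo) (Q? lo)))
            (countIn-cong P? Q? P⇔Q (suc lo) len)

countIn-+ : (P? : Decidable P) (k lo len : ℕ) →
  countIn P? (lo + k) len ≡ countIn (λ x → P? (x + k)) lo len
countIn-+ P? k lo zero      = refl
countIn-+ P? k lo (suc len) = cong (_+_ (ind (P? (lo + k)))) (countIn-+ P? k (suc lo) len)

countIn-none : (P? : Decidable P) (lo len : ℕ) →
  (∀ {x} → InRange lo len x → ¬ P x) → countIn P? lo len ≡ 0
countIn-none P? lo zero      none = refl
countIn-none P? lo (suc len) none with P? lo
... | yes p = ⊥-elim (none inRange-head p)
... | no _  = countIn-none P? (suc lo) len (none ∘ inRange-tail)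

countIn-≤1 : (P? : Decidable P) → (∀ {x y} → P x → P y → x ≡ y) →
  (lo len : ℕ) → countIn P? lo len ≤ 1
countIn-≤1 P? unique lo zero = z≤n
countIn-≤1 P? unique lo (suc len) with P? lo
... | yes p = ≤-reflexive (cong suc (countIn-none P? (suc lo) len
                λ (lo<x , _) q → <-irrefl (unique p q) lo<x))
... | no _  = countIn-≤1 P? unique (suc lo) len

countIn-∈ : (ys : List ℕ) (lo len : ℕ) → countIn (_∈? ys) lo len ≤ length ys
countIn-∈ []       lo len = ≤-reflexive (countIn-none (_∈? []) lo len λ _ ())
countIn-∈ (y ∷ ys) lo len = begin
  countIn (_∈? y ∷ ys) lo len                     ≤⟨ countIn-mono (_∈? y ∷ ys) ≡y⊎∈ys? lo len (λ _ → ∈-∷⁻) ⟩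
  countIn ≡y⊎∈ys? lo len                          ≤⟨ countIn-⊎ (_≟ y) (_∈? ys) lo len ⟩
  countIn (_≟ y) lo len + countIn (_∈? ys) lo len ≤⟨ +-mono-≤ (countIn-≤1 (_≟ y) ≡y-unique lo len) (countIn-∈ ys lo len) ⟩
  suc (length ys)                                 ∎
  where
    open ≤-Reasoning
    ≡y⊎∈ys? : Decidable (λ x → x ≡ y ⊎ x ∈ ys)
    ≡y⊎∈ys? x = (x ≟ y) ⊎-dec (x ∈? ys)
    ≡y-unique : ∀ {x z} → x ≡ y → z ≡ y → x ≡ z
    ≡y-unique x≡y z≡y = trans x≡y (sym z≡y)
    ∈-∷⁻ : ∀ {x} → x ∈ y ∷ ys → x ≡ y ⊎ x ∈ ys
    ∈-∷⁻ (here x≡y) = inj₁ x≡y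
    ∈-∷⁻ (there x∈ys) = inj₂ x∈ys

interval : ℕ → ℕ → List ℕ
interval lo zero      = []
interval lo (suc len) = lo ∷ interval (suc lo) len

∈-interval⁺ : InRange lo len x → x ∈ interval lo len
∈-interval⁺ {lo} {zero}    {x} (lo≤x , x<) = ⊥-elim (<⇒≱ (subst (x <_) (+-identityʳ lo) x<) lo≤x)
∈-interval⁺ {lo} {suc len} {x} (lo≤x , x<) with m≤n⇒m<n∨m≡n lo≤x
... | inj₂ refl = here refl
... | inj₁ lo<x = there (∈-interval⁺ (lo<x , subst (x <_) (+-suc lo len) x<))

∈-filter-interval⁺ : (P? : Decidable P) → InRange lo len x → P x → x ∈ filter P? (interval lo len)
∈-filter-interval⁺ P? x∈ px = ∈-filter⁺ P? (∈-interval⁺ x∈) px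

length-filter-interval : (P? : Decidable P) (lo len : ℕ) →
  length (filter P? (interval lo len)) ≡ countIn P? lo len
length-filter-interval P? lo zero = refl
length-filter-interval P? lo (suc len) with P? lo
... | yes _ = cong suc (length-filter-interval P? (suc lo) len)
... | no _  = length-filter-interval P? (suc lo) len

length-cartesianProductWith : (f : A → B → C) (xs : List A) (ys : List B) →
  length (cartesianProductWith f xs ys) ≡ length xs * length ys
length-cartesianProductWith f []       ys = refl
length-cartesianProductWith f (x ∷ xs) ys = begin
  length (map (f x) ys ++ cartesianProductWith f xs ys)
    ≡⟨ length-++ (map (f x) ys) ⟩
  length (map (f x) ys) + length (cartesianProductWith f xs ys)
    ≡⟨ cong₂ _+_ (length-map (f x) ys) (length-cartesianProductWith f xs ys) ⟩
  length ys + length xs * length ys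
    ∎
  where open ≡-Reasoning

module Apery (S : NumericalSemigroup) {m : ℕ} (m∈S : _∈S S m) where
  open NumericalSemigroup S using () renaming (_∈S to _∈ₛ; _∈S? to _∈ₛ?)

  InShifted : ℕ → Set
  InShifted x = m ≤ x × (x ∸ m) ∈ₛ

  inShifted? : Decidable InShifted
  inShifted? x = (m ≤? x) ×-dec ((x ∸ m) ∈ₛ?)

  shifted-+ : ∀ {s t} → InShifted s → t ∈ₛ → InShifted (s + t)
  shifted-+ {s} {t} (m≤s , s-m∈S) t∈S =
    ≤-trans m≤s (m≤m+n s t) , subst _∈ₛ (sym (+-∸-comm t m≤s)) (+-closed S s-m∈S t∈S)

  shifted-+m : ∀ x → InShifted (x + m) ⇔ x ∈ₛ
  shifted-+m x = mk⇔ (λ (_ , x∈S) → subst _∈ₛ (m+n∸n≡m x m) x∈S)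
                     (λ x∈S → m≤n+m m x , subst _∈ₛ (sym (m+n∸n≡m x m)) x∈S)

  apery⊎shifted : ∀ {x} → x ∈ₛ → InApery S m x ⊎ InShifted x
  apery⊎shifted {x} x∈S with inShifted? x
  ... | yes sh  = inj₂ sh
  ... | no ¬sh = inj₁ (x∈S , λ m≤x x-m∈S → ¬sh (m≤x , x-m∈S))

  shifted⇒∈S : ∀ {x} → InShifted x → x ∈ₛ
  shifted⇒∈S (m≤x , x-m∈S) = subst _∈ₛ (m∸n+n≡m m≤x) (+-closed S x-m∈S m∈S)

  apery⇒¬shifted : ∀ {x} → InApery S m x → ¬ InShifted x
  apery⇒¬shifted (_ , ¬x-m∈S) (m≤x , x-m∈S) = ¬x-m∈S m≤x x-m∈S

  countIn-∈S : (lo len : ℕ) →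
    countIn _∈ₛ? lo len ≡ countIn (inApery? S m) lo len + countIn inShifted? lo len
  countIn-∈S lo len = trans
    (countIn-cong _∈ₛ? (λ x → inApery? S m x ⊎-dec inShifted? x)
      (λ x → mk⇔ apery⊎shifted [ proj₁ , shifted⇒∈S ]) lo len)
    (countIn-⊎-disjoint (inApery? S m) inShifted? apery⇒¬shifted lo len)

  cardApery : ℕ → ℕ
  cardApery n = countIn (inApery? S m) 0 n

  countIn-shifted-<m : countIn inShifted? 0 m ≡ 0
  countIn-shifted-<m = countIn-none inShifted? 0 m λ (_ , x<m) (m≤x , _) → <⇒≱ x<m m≤x

  countIn-shifted-+m : (lo len : ℕ) → countIn inShifted? (lo + m) len ≡ countIn _∈ₛ? lo len
  countIn-shifted-+m lo len =
    trans (countIn-+ inShifted? m lo len) (countIn-cong _ _∈ₛ? shifted-+m lo len)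

  cardL-+m : (n : ℕ) → cardL S (n + m) ≡ cardApery (n + m) + cardL S n
  cardL-+m n = begin
    cardL S (n + m)                                  ≡⟨ countIn-∈S 0 (n + m) ⟩
    cardApery (n + m) + countIn inShifted? 0 (n + m) ≡⟨ cong (_+_ (cardApery (n + m))) shifted-below ⟩
    cardApery (n + m) + cardL S n                    ∎
    where
      open ≡-Reasoning
      shifted-below : countIn inShifted? 0 (n + m) ≡ cardL S n
      shifted-below = begin
        countIn inShifted? 0 (n + m)                    ≡⟨ cong (countIn inShifted? 0) (+-comm n m) ⟩
        countIn inShifted? 0 (m + n)                    ≡⟨ countIn-++ inShifted? 0 m n ⟩
        countIn inShifted? 0 m + countIn inShifted? m n ≡⟨ cong₂ _+_ countIn-shifted-<m (countIn-shifted-+m 0 n) ⟩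
        cardL S n                                       ∎

  countIn-∈S-window : (n : ℕ) → countIn _∈ₛ? n m ≡ cardApery (n + m)
  countIn-∈S-window n = +-cancelˡ-≡ (cardL S n) _ _ (begin
    cardL S n + countIn _∈ₛ? n m  ≡⟨ countIn-++ _∈ₛ? 0 n m ⟨
    cardL S (n + m)               ≡⟨ cardL-+m n ⟩
    cardApery (n + m) + cardL S n ≡⟨ +-comm (cardApery (n + m)) (cardL S n) ⟩
    cardL S n + cardApery (n + m) ∎)
    where open ≡-Reasoning

  NonzeroApery : ℕ → Set
  NonzeroApery y = InApery S m y × 0 < y

  AperySum : ℕ → Set
  AperySum x = Σ ℕ λ s → Σ ℕ λ t → NonzeroApery s × NonzeroApery t × s + t ≡ x

  decomposable⇒shifted⊎aperySum : ∀ {x} → Decomposable S x → InShifted x ⊎ AperySum x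
  decomposable⇒shifted⊎aperySum (s , t , (s∈S , s>0) , (t∈S , t>0) , refl)
    with apery⊎shifted s∈S | apery⊎shifted t∈S
  ... | inj₂ s-sh | _         = inj₁ (shifted-+ s-sh t∈S)
  ... | inj₁ _    | inj₂ t-sh = inj₁ (subst InShifted (+-comm t s) (shifted-+ t-sh s∈S))
  ... | inj₁ s-ap | inj₁ t-ap = inj₂ (s , t , (s-ap , s>0) , (t-ap , t>0) , refl)

inD⇒decomposable : (S : NumericalSemigroup) {x : ℕ} → InD S x → Decomposable S x
inD⇒decomposable S {x} (nonzero , ¬primitive) with decomposable? S x
... | yes d  = d
... | no ¬d = ⊥-elim (¬primitive (nonzero , ¬d))

module Multiplicity (S : NumericalSemigroup) {m : ℕ} (mult : IsMultiplicity S m) where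
  open NumericalSemigroup S using () renaming (_∈S to _∈ₛ; _∈S? to _∈ₛ?)
  open Apery S (proj₁ mult) public

  m-least : ∀ {x} → x ∈ₛ → 0 < x → m ≤ x
  m-least = proj₂ (proj₂ mult) _

  ∉S-<m : ∀ {x} → 0 < x → x < m → ¬ x ∈ₛ
  ∉S-<m x>0 x<m x∈S = <⇒≱ x<m (m-least x∈S x>0)

  cardL-≤m : ∀ {n} → 0 < n → n ≤ m → cardL S n ≡ 1
  cardL-≤m {suc n} _ n<m with 0 ∈ₛ?
  ... | yes _    = cong suc (countIn-none _∈ₛ? 1 n λ (0<x , x<1+n) → ∉S-<m 0<x (<-≤-trans x<1+n n<m))
  ... | no 0∉S = ⊥-elim (0∉S (0∈S S))

  cardApery-≤m : ∀ {n} → n ≤ m → cardApery n ≡ cardL S n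
  cardApery-≤m {n} n≤m = sym (begin
    cardL S n                            ≡⟨ countIn-∈S 0 n ⟩
    cardApery n + countIn inShifted? 0 n ≡⟨ cong (_+_ (cardApery n)) no-shifted ⟩
    cardApery n + 0                      ≡⟨ +-identityʳ (cardApery n) ⟩
    cardApery n                          ∎)
    where
      open ≡-Reasoning
      no-shifted : countIn inShifted? 0 n ≡ 0
      no-shifted = countIn-none inShifted? 0 n λ (_ , x<n) (m≤x , _) → <⇒≱ (<-≤-trans x<n n≤m) m≤x

  primitive-<2m : ∀ {x} → x ∈ₛ → 0 < x → x < m + m → Primitive S x
  primitive-<2m x∈S x>0 x<2m = (x∈S , x>0) , λ (s , t , (s∈S , s>0) , (t∈S , t>0) , s+t≡x) →
    <⇒≱ x<2m (subst (m + m ≤_) s+t≡x (+-mono-≤ (m-least s∈S s>0) (m-least t∈S t>0)))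

module TwoAperyInFirstInterval (S : NumericalSemigroup) {m : ℕ} (mult : IsMultiplicity S m)
  {ρ : ℕ} (ρ<m : ρ < m) (α₁≡2 : alpha1 S m ρ ≡ 2) where
  open NumericalSemigroup S using () renaming (_∈S to _∈ₛ; _∈S? to _∈ₛ?)
  open Multiplicity S mult

  r : ℕ
  r = intervalStart m ρ 1

  r>0 : 0 < r
  r>0 = m<n⇒0<n∸m (subst (ρ <_) (sym (*-identityˡ m)) ρ<m)

  r≤m : r ≤ m
  r≤m = subst (r ≤_) (*-identityˡ m) (m∸n≤m (1 * m) ρ)

  -- pos j = (j + 1)m − ρ, the left end of I_{j+1}
  pos : ℕ → ℕ
  pos zero    = r
  pos (suc j) = pos j + m

  intervalStart≡pos : ∀ j → intervalStart m ρ (suc j) ≡ pos j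
  intervalStart≡pos zero    = refl
  intervalStart≡pos (suc j) = begin
    (m + suc j * m) ∸ ρ   ≡⟨ +-∸-assoc m (≤-trans (<⇒≤ ρ<m) (m≤m+n m (j * m))) ⟩
    m + (suc j * m ∸ ρ)   ≡⟨ cong (_+_ m) (intervalStart≡pos j) ⟩
    m + pos j             ≡⟨ +-comm m (pos j) ⟩
    pos j + m             ∎
    where open ≡-Reasoning

  r≤pos : ∀ j → r ≤ pos j
  r≤pos zero    = ≤-refl
  r≤pos (suc j) = ≤-trans (r≤pos j) (m≤m+n (pos j) m)

  α₂ α₃ : ℕ
  α₂ = countIn (inApery? S m) (pos 1) m
  α₃ = countIn (inApery? S m) (pos 2) m

  cardApery-pos₀ : cardApery (pos 0) ≡ 1
  cardApery-pos₀ = trans (cardApery-≤m r≤m) (cardL-≤m r>0 r≤m)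

  cardApery-pos₁ : cardApery (pos 1) ≡ 3
  cardApery-pos₁ = trans (countIn-++ (inApery? S m) 0 r m) (cong₂ _+_ cardApery-pos₀ α₁≡2)

  cardApery-pos₂ : cardApery (pos 2) ≡ 3 + α₂
  cardApery-pos₂ = trans (countIn-++ (inApery? S m) 0 (pos 1) m) (cong (_+ α₂) cardApery-pos₁)

  cardApery-pos₃ : cardApery (pos 3) ≡ 3 + α₂ + α₃
  cardApery-pos₃ = trans (countIn-++ (inApery? S m) 0 (pos 2) m) (cong (_+ α₃) cardApery-pos₂)

  3≤cardApery : ∀ {n} → pos 1 ≤ n → 3 ≤ cardApery n
  3≤cardApery h = subst (_≤ _) cardApery-pos₁ (countIn-mono-len (inApery? S m) 0 h)

  cardL-pos : ∀ j → 3 * j < cardL S (pos j)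
  cardL-pos zero    = ≤-reflexive (sym (cardL-≤m r>0 r≤m))
  cardL-pos (suc j) = begin-strict
    3 * suc j                               ≡⟨ *-suc 3 j ⟩
    3 + 3 * j                               <⟨ +-mono-≤-< (3≤cardApery (+-monoˡ-≤ m (r≤pos j))) (cardL-pos j) ⟩
    cardApery (pos j + m) + cardL S (pos j) ≡⟨ cardL-+m (pos j) ⟨
    cardL S (pos (suc j))                   ∎
    where open ≤-Reasoning

  cardL-pos₃ : cardL S (pos 3) ≡ 10 + (α₂ + α₂ + α₃)
  cardL-pos₃ = begin
    cardL S (pos 3)
      ≡⟨ cardL-+m (pos 2) ⟩
    cardApery (pos 3) + cardL S (pos 2)
      ≡⟨ cong (_+_ (cardApery (pos 3))) (cardL-+m (pos 1)) ⟩
    cardApery (pos 3) + (cardApery (pos 2) + cardL S (pos 1))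
      ≡⟨ cong (λ k → cardApery (pos 3) + (cardApery (pos 2) + k)) (cardL-+m (pos 0)) ⟩
    cardApery (pos 3) + (cardApery (pos 2) + (cardApery (pos 1) + cardL S r))
      ≡⟨ cong₂ _+_ cardApery-pos₃ (cong₂ _+_ cardApery-pos₂ (cong₂ _+_ cardApery-pos₁ (cardL-≤m r>0 r≤m))) ⟩
    3 + α₂ + α₃ + (3 + α₂ + (3 + 1))
      ≡⟨ regroup α₂ α₃ ⟩
    10 + (α₂ + α₂ + α₃)
      ∎
    where
      open ≡-Reasoning
      regroup : ∀ a b → 3 + a + b + (3 + a + (3 + 1)) ≡ 10 + (a + a + b)
      regroup = solve-∀

  cardPL≥3 : ∀ {n} → pos 1 ≤ n → 3 ≤ cardPL S n
  cardPL≥3 {n} pos₁≤n = begin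
    3                                                   ≡⟨ trans (sym cardApery-pos₁) (sym (countIn-∈S-window r)) ⟩
    countIn _∈ₛ? r m                                     ≤⟨ countIn-mono _∈ₛ? (primitive? S) r m small⇒primitive ⟩
    countIn (primitive? S) r m                           ≤⟨ m≤n+m _ _ ⟩
    countIn (primitive? S) 0 r + countIn (primitive? S) r m ≡⟨ countIn-++ (primitive? S) 0 r m ⟨
    countIn (primitive? S) 0 (pos 1)                     ≤⟨ countIn-mono-len (primitive? S) 0 pos₁≤n ⟩
    cardPL S n                                           ∎
    where
      open ≤-Reasoning
      small⇒primitive : ∀ {x} → InRange r m x → x ∈ₛ → Primitive S x
      small⇒primitive (r≤x , x<r+m) x∈S =
        primitive-<2m x∈S (<-≤-trans r>0 r≤x) (<-≤-trans x<r+m (+-monoˡ-≤ m r≤m))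

  A₁ A₂ A₂₃ : List ℕ
  A₁  = filter (inApery? S m) (interval (pos 0) m)
  A₂  = filter (inApery? S m) (interval (pos 1) m)
  A₂₃ = filter (inApery? S m) (interval (pos 1) (m + m))

  data Summand (y : ℕ) : Set where
    in₁ : y ∈ A₁ → y < pos 1 → Summand y
    in₂ : y ∈ A₂ → y ∈ A₂₃ → Summand y
    in₃ : y ∈ A₂₃ → pos 2 ≤ y → Summand y

  summand : ∀ {y} → NonzeroApery y → y < pos 3 → Summand y
  summand {y} (y-ap , y>0) y<pos₃ with y <? pos 1 | y <? pos 2
  ... | yes y<pos₁ | _ =
    in₁ (∈-filter-interval⁺ (inApery? S m) (r≤y , y<pos₁) y-ap) y<pos₁
    where r≤y = ≤-trans r≤m (m-least (proj₁ y-ap) y>0)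
  ... | no y≮pos₁ | yes y<pos₂ =
    in₂ (∈-filter-interval⁺ (inApery? S m) (≮⇒≥ y≮pos₁ , y<pos₂) y-ap)
        (∈-filter-interval⁺ (inApery? S m) (≮⇒≥ y≮pos₁ , y<pos₁+2m) y-ap)
    where y<pos₁+2m = <-≤-trans y<pos₂ (+-monoʳ-≤ (pos 1) (m≤m+n m m))
  ... | no y≮pos₁ | no y≮pos₂ =
    in₃ (∈-filter-interval⁺ (inApery? S m) (≮⇒≥ y≮pos₁ , y<pos₁+2m) y-ap) (≮⇒≥ y≮pos₂)
    where y<pos₁+2m = subst (y <_) (+-assoc (pos 1) m m) y<pos₃

  pos₁+pos₁≤pos₃ : pos 1 + pos 1 ≤ pos 3
  pos₁+pos₁≤pos₃ = ≤-trans (≤-reflexive (regroup r m)) (+-monoʳ-≤ (pos 2) r≤m)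
    where
      regroup : ∀ r m → r + m + (r + m) ≡ r + m + m + r
      regroup = solve-∀

  pos₄≤pos₂+pos₂ : pos 4 ≤ pos 2 + pos 2
  pos₄≤pos₂+pos₂ = ≤-trans (m≤m+n (pos 4) r) (≤-reflexive (regroup r m))
    where
      regroup : ∀ r m → r + m + m + m + m + r ≡ r + m + m + (r + m + m)
      regroup = solve-∀

  sums : List ℕ
  sums = cartesianProductWith _+_ A₂₃ (A₁ ++ A₂)

  left-summand<pos₃ : ∀ {s t} → NonzeroApery t → s + t < pos 4 → s < pos 3
  left-summand<pos₃ {s} ((t∈S , _) , t>0) s+t<pos₄ =
    +-cancelʳ-< m s (pos 3) (≤-<-trans (+-monoʳ-≤ s (m-least t∈S t>0)) s+t<pos₄)

  sum∈sums : ∀ {e y} → e ∈ A₂₃ → y ∈ A₁ ++ A₂ → e + y ∈ sums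
  sum∈sums = ∈-cartesianProductWith⁺ _+_

  sum∈sums′ : ∀ {e y} → y ∈ A₁ ++ A₂ → e ∈ A₂₃ → y + e ∈ sums
  sum∈sums′ {e} {y} y∈ e∈ = subst (_∈ sums) (+-comm e y) (sum∈sums e∈ y∈)

  -- Two summands from I₁ are too small and two from I₃ too large to add up to an element of I₄.
  aperySum⇒∈sums : ∀ {x} → InRange (pos 3) m x → AperySum x → x ∈ sums
  aperySum⇒∈sums (pos₃≤x , x<pos₄) (s , t , s-nap , t-nap , refl)
    with summand s-nap (left-summand<pos₃ t-nap x<pos₄)
       | summand t-nap (left-summand<pos₃ s-nap (subst (_< pos 4) (+-comm s t) x<pos₄))
  ... | in₁ _ s<pos₁  | in₁ _ t<pos₁  =
    ⊥-elim (<⇒≱ (<-≤-trans (+-mono-< s<pos₁ t<pos₁) pos₁+pos₁≤pos₃) pos₃≤x)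
  ... | in₁ s∈A₁ _    | in₂ _ t∈A₂₃  = sum∈sums′ (∈-++⁺ˡ s∈A₁) t∈A₂₃
  ... | in₁ s∈A₁ _    | in₃ t∈A₂₃ _  = sum∈sums′ (∈-++⁺ˡ s∈A₁) t∈A₂₃
  ... | in₂ _ s∈A₂₃   | in₁ t∈A₁ _   = sum∈sums s∈A₂₃ (∈-++⁺ˡ t∈A₁)
  ... | in₂ _ s∈A₂₃   | in₂ t∈A₂ _   = sum∈sums s∈A₂₃ (∈-++⁺ʳ A₁ t∈A₂)
  ... | in₂ s∈A₂ _    | in₃ t∈A₂₃ _  = sum∈sums′ (∈-++⁺ʳ A₁ s∈A₂) t∈A₂₃
  ... | in₃ s∈A₂₃ _   | in₁ t∈A₁ _   = sum∈sums s∈A₂₃ (∈-++⁺ˡ t∈A₁)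
  ... | in₃ s∈A₂₃ _   | in₂ t∈A₂ _   = sum∈sums s∈A₂₃ (∈-++⁺ʳ A₁ t∈A₂)
  ... | in₃ _ pos₂≤s  | in₃ _ pos₂≤t  =
    ⊥-elim (<⇒≱ x<pos₄ (≤-trans pos₄≤pos₂+pos₂ (+-mono-≤ pos₂≤s pos₂≤t)))

  length-sums : length sums ≡ (α₂ + α₃) * (2 + α₂)
  length-sums = begin
    length sums                          ≡⟨ length-cartesianProductWith _+_ A₂₃ (A₁ ++ A₂) ⟩
    length A₂₃ * length (A₁ ++ A₂)       ≡⟨ cong (length A₂₃ *_) (length-++ A₁) ⟩
    length A₂₃ * (length A₁ + length A₂) ≡⟨ cong₂ (λ a b → a * (b + length A₂)) length-A₂₃ length-A₁ ⟩
    (α₂ + α₃) * (2 + length A₂)          ≡⟨ cong (λ b → (α₂ + α₃) * (2 + b)) length-A₂ ⟩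
    (α₂ + α₃) * (2 + α₂)                 ∎
    where
      open ≡-Reasoning
      length-A₁ : length A₁ ≡ 2
      length-A₁ = trans (length-filter-interval (inApery? S m) r m) α₁≡2
      length-A₂ : length A₂ ≡ α₂
      length-A₂ = length-filter-interval (inApery? S m) (pos 1) m
      length-A₂₃ : length A₂₃ ≡ α₂ + α₃
      length-A₂₃ = trans (length-filter-interval (inApery? S m) (pos 1) (m + m))
                         (countIn-++ (inApery? S m) (pos 1) m m)

  cardD-pos₃ : countIn (inD? S) (pos 3) m ≤ 3 + α₂ + α₃ + (α₂ + α₃) * (2 + α₂)
  cardD-pos₃ = begin
    countIn (inD? S) (pos 3) m
      ≤⟨ countIn-mono (inD? S) shifted⊎∈sums? (pos 3) m cover ⟩
    countIn shifted⊎∈sums? (pos 3) m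
      ≤⟨ countIn-⊎ inShifted? (_∈? sums) (pos 3) m ⟩
    countIn inShifted? (pos 3) m + countIn (_∈? sums) (pos 3) m
      ≤⟨ +-monoʳ-≤ (countIn inShifted? (pos 3) m) (countIn-∈ sums (pos 3) m) ⟩
    countIn inShifted? (pos 3) m + length sums
      ≡⟨ cong₂ _+_ cardShifted length-sums ⟩
    3 + α₂ + α₃ + (α₂ + α₃) * (2 + α₂)
      ∎
    where
      open ≤-Reasoning
      shifted⊎∈sums? : Decidable (λ x → InShifted x ⊎ x ∈ sums)
      shifted⊎∈sums? x = inShifted? x ⊎-dec (x ∈? sums)
      cover : ∀ {x} → InRange (pos 3) m x → InD S x → InShifted x ⊎ x ∈ sums
      cover x∈ d =
        Sum.map₂ (aperySum⇒∈sums x∈) (decomposable⇒shifted⊎aperySum (inD⇒decomposable S d))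
      cardShifted : countIn inShifted? (pos 3) m ≡ 3 + α₂ + α₃
      cardShifted =
        trans (countIn-shifted-+m (pos 2) m) (trans (countIn-∈S-window (pos 2)) cardApery-pos₃)

  4*cardD≤cardPL*cardL : cardL S (pos 3) ≤ 12 →
    4 * countIn (inD? S) (pos 3) m ≤ cardPL S (pos 3) * cardL S (pos 3)
  4*cardD≤cardPL*cardL L≤12 = begin
    4 * countIn (inD? S) (pos 3) m                  ≤⟨ *-monoʳ-≤ 4 cardD-pos₃ ⟩
    4 * (3 + α₂ + α₃ + (α₂ + α₃) * (2 + α₂))        ≤⟨ arith α₂ α₃ 2α₂+α₃≤2 ⟩
    3 * (10 + (α₂ + α₂ + α₃))                       ≡⟨ cong (3 *_) cardL-pos₃ ⟨
    3 * cardL S (pos 3)                             ≤⟨ *-monoˡ-≤ (cardL S (pos 3)) (cardPL≥3 pos₁≤pos₃) ⟩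
    cardPL S (pos 3) * cardL S (pos 3)              ∎
    where
      open ≤-Reasoning
      2α₂+α₃≤2 : α₂ + α₂ + α₃ ≤ 2
      2α₂+α₃≤2 = +-cancelˡ-≤ 10 _ _ (subst (_≤ 12) cardL-pos₃ L≤12)
      pos₁≤pos₃ : pos 1 ≤ pos 3
      pos₁≤pos₃ = ≤-trans (m≤m+n (pos 1) m) (m≤m+n (pos 2) m)
      arith : ∀ a b → a + a + b ≤ 2 → 4 * (3 + a + b + (a + b) * (2 + a)) ≤ 3 * (10 + (a + a + b))
      arith 0 0 _ = ≤ᵇ⇒≤ 12 30 _
      arith 0 1 _ = ≤ᵇ⇒≤ 24 33 _
      arith 0 2 _ = ≤ᵇ⇒≤ 36 36 _
      arith 1 0 _ = ≤ᵇ⇒≤ 28 36 _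
      arith 0 (suc (suc (suc _))) (s≤s (s≤s ()))
      arith 1 (suc _)             (s≤s (s≤s ()))
      arith (suc (suc zero)) _    (s≤s (s≤s ()))
      arith (suc (suc (suc _))) _ (s≤s (s≤s ()))

offset<m : ∀ c m q → IsCeilDiv c m q → offset c m q < m
offset<m c m q (c≤qm , qm<c+m) = +-cancelʳ-< c (offset c m q) m (begin-strict
  offset c m q + c ≡⟨ m∸n+n≡m c≤qm ⟩
  q * m            <⟨ qm<c+m ⟩
  c + m            ≡⟨ +-comm c m ⟩
  m + c            ∎)
  where open ≤-Reasoning

intervalStart-offset : ∀ c m q → IsCeilDiv c m q → intervalStart m (offset c m q) q ≡ c
intervalStart-offset c m q (c≤qm , _) = m∸[m∸n]≡n c≤qm

0≤a-b+d : ∀ {a b} d → b ≤ a → + 0 ℤ.≤ (+ a ℤ.- + b) ℤ.+ + d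
0≤a-b+d d b≤a = ℤP.+-mono-≤ (ℤP.i≤j⇒0≤j-i (ℤ.+≤+ b≤a)) (ℤ.+≤+ z≤n)

proposition4p5 : (S : NumericalSemigroup) (m c q : ℕ) →
    IsMultiplicity S m → IsConductor S c → IsCeilDiv c m q →
    4 ≤ q → cardL S c ≤ 12 → alpha1 S m (offset c m q) ≡ 2 →
    q ≡ 4 × (+ 0) ℤ.≤ W0 S m c q
proposition4p5 S m c q mult _ ceil 4≤q L≤12 α₁≡2 with m≤n⇒m<n∨m≡n 4≤q
... | inj₁ 4<q = ⊥-elim (<⇒≱ (cardL-pos 4) (≤-trans (countIn-mono-len (_∈S? S) 0 pos₄≤c) L≤12))
  where
    open TwoAperyInFirstInterval S mult (offset<m c m q ceil) α₁≡2
    pos₄≤c : pos 4 ≤ c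
    pos₄≤c = begin
      pos 4                            ≡⟨ intervalStart≡pos 4 ⟨
      intervalStart m (offset c m q) 5 ≤⟨ ∸-monoˡ-≤ (offset c m q) (*-monoˡ-≤ m 4<q) ⟩
      intervalStart m (offset c m q) q ≡⟨ intervalStart-offset c m q ceil ⟩
      c                                ∎
      where open ≤-Reasoning
... | inj₂ refl = refl , 0≤a-b+d (offset c m 4) 4D≤PL*L
  where
    open TwoAperyInFirstInterval S mult (offset<m c m 4 ceil) α₁≡2
    pos₃≡c : pos 3 ≡ c
    pos₃≡c = trans (sym (intervalStart≡pos 3)) (intervalStart-offset c m 4 ceil)
    4D≤PL*L : 4 * cardD S m (offset c m 4) 4 ≤ cardPL S c * cardL S c
    4D≤PL*L = subst₂ (λ i n → 4 * countIn (inD? S) i m ≤ cardPL S n * cardL S n)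
      (sym (intervalStart≡pos 3)) pos₃≡c
      (4*cardD≤cardPL*cardL (subst (_≤ 12) (cong (cardL S) (sym pos₃≡c)) L≤12))
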